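{- Let $p$ be a prime and let $C\subseteq\mathbb{Z}/p\mathbb{Z}$ with $0\in C$, $c:=\ell(C)<p/2$, and $C\subseteq\{0,1,\dots,c-1\}$ (residues mod $p$). Let $t$ be a positive integer with $t<p/(2c)$, and for $i=1,\dots,2t$ let $I_i=\{(i-1)c,(i-1)c+1,\dots,ic-1\}$ (mod $p$), and $I=I_1\cup\dots\cup I_{2t}$. Let $B\subseteq\mathbb{Z}/p\mathbb{Z}$ be such that $B\cap I_i\neq\emptyset$ for every $i=1,\dots,2t$. Then $$|B+C|\ \ge\ |B\cup((B+C)\cap I)|\ \ge\ |B|+\left(t-\tfrac12\right)\ell(C)\left(\rho C-\frac{|B\cap I|}{(2t-1)c}\right).$$
   Context: For $X\subseteq\mathbb{Z}/p\mathbb{Z}$, $\ell(X)$ denotes the length (number of terms) of a shortest arithmetic progression in $\mathbb{Z}/p\mathbb{Z}$ containing $X$, and the density of $X$ is $\rho X=(|X|-1)/\ell(X)$. -}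

module Defs where

open import Data.Nat using (ℕ; zero; suc; _+_; _*_; _∸_; _<_; NonZero)
open import Data.Nat.DivMod using (_%_)
open import Data.Fin using (Fin; toℕ)
open import Data.Fin.Subset using (Subset; _∈_; ⋃)
open import Data.Bool using (Bool; _∧_)
open import Data.List using (List; upTo; map; applyUpTo)
open import Data.Bool.ListAction using (any)
open import Data.List using () renaming (allFin to allFinL)
open import Data.Vec using (tabulate; lookup)
open import Data.Product using (Σ; ∃; _×_)
open import Data.Integer using (+_)
open import Data.Rational using (ℚ; _/_; 0ℚ) renaming (_*_ to _*ℚ_)
open import Relation.Nullary.Decidable using (⌊_⌋)
open import Relation.Binary.PropositionalEquality using (_≡_)
import Data.Nat as ℕ

-- Z/pZ is modelled as Fin p (residues 0..p-1); subsets of Z/pZ as Subset p.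
-- Residue of a natural number n, compared through toℕ: x "is" n mod p.
_≡ₚ_ : ∀ {p} .{{_ : NonZero p}} → Fin p → ℕ → Set
_≡ₚ_ {p} x n = toℕ x ≡ n % p

InAP : ∀ {p} .{{_ : NonZero p}} → ℕ → ℕ → ℕ → Fin p → Set
InAP a d k x = Σ ℕ λ j → j < k × (x ≡ₚ (a + j * d))

APCover : ∀ {p} .{{_ : NonZero p}} → Subset p → ℕ → Set
APCover {p} X k = Σ (Fin p) λ a → Σ (Fin p) λ d →
  ∀ x → x ∈ X → InAP (toℕ a) (toℕ d) k x

IsℓOf : ∀ {p} .{{_ : NonZero p}} → Subset p → ℕ → Set
IsℓOf X c = APCover X c × (∀ k → APCover X k → c ℕ.≤ k)

_⊕_ : ∀ {p} .{{_ : NonZero p}} → Subset p → Subset p → Subset p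
_⊕_ {p} B C = tabulate λ x →
  any (λ b → any (λ c → lookup B b ∧ lookup C c
        ∧ ⌊ toℕ x ℕ.≟ (toℕ b + toℕ c) % p ⌋) (allFinL p)) (allFinL p)

segment : ∀ {p} .{{_ : NonZero p}} → ℕ → ℕ → Subset p
segment {p} a len = tabulate λ x →
  any (λ j → ⌊ toℕ x ℕ.≟ (a + j) % p ⌋) (upTo len)

Iᵢ : ∀ {p} .{{_ : NonZero p}} → ℕ → ℕ → Subset p
Iᵢ c i = segment ((i ∸ 1) * c) c

Iall : ∀ {p} .{{_ : NonZero p}} → ℕ → ℕ → Subset p
Iall c t = ⋃ (applyUpTo (λ i → Iᵢ c (suc i)) (2 * t))

ℕ→ℚ : ℕ → ℚ
ℕ→ℚ n = + n / 1

-- q / d for d a natural; only used with d ≥ 1 (value at d = 0 is irrelevant).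
_÷ℕ_ : ℚ → ℕ → ℚ
q ÷ℕ zero = 0ℚ
q ÷ℕ suc k = q *ℚ (+ 1 / suc k)

-- density ρX = (|X| - 1) / ℓ(X), given |X| and ℓ(X).
ρ : ℕ → ℕ → ℚ
ρ card ℓ = ℕ→ℚ (card ∸ 1) ÷ℕ ℓ

{-# OPTIONS --safe #-}
-- Put X = B ∪ ((B + C) ∩ I) and N = 2tc. Since N < p, residues in [0, N) add without wrap-around,
-- so the argument can be run on ℕ, where I_{j+1} = [jc, jc + c). If r is the largest element of
-- B ∩ I_{j+1} and j + 1 < 2t, then r + C ⊆ X lies in [r, r + c) ⊆ I_{j+1} ∪ I_{j+2}, above the
-- elements of B ∩ I_{j+1} other than r; hence
--   |B ∩ I_{j+1}| + |C| − 1 ≤ |X ∩ I_{j+1}| + |X ∩ I_{j+2}|.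
-- Summing over j < 2t − 1 and adding |B ∩ I_{2t}| ≤ |X ∩ I_{2t}| gives
-- |B ∩ I| + (2t − 1)(|C| − 1) ≤ 2|X ∩ I|, and outside I simply B ⊆ X. So
-- 2|B| + (2t − 1)(|C| − 1) ≤ 2|X| + |B ∩ I|, which is twice the density bound.
module Submission where

open import Defs
open import Data.Bool using (Bool; true; false; T; if_then_else_)
open import Data.Bool.Properties using (T-≡; T-∧)
open import Data.Fin using (Fin; toℕ; fromℕ<; zero; suc)
open import Data.Fin.Properties using (toℕ<n; toℕ-fromℕ<)
open import Data.Fin.Subset using (Subset; _∈_; _⊆_; _∩_; _∪_; ∣_∣; Nonempty; ⋃)
open import Data.Fin.Subset.Properties using (x∈p∪q⁺; x∈p∪q⁻; x∈p∩q⁺; x∈p∩q⁻; p⊆q⇒∣p∣≤∣q∣)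
import Data.Integer as ℤ
import Data.Integer.Properties as ℤ
open import Data.List.Membership.Propositional using (lose; find) renaming (_∈_ to _∈ᴸ_)
open import Data.List.Membership.Propositional.Properties using (∈-allFin; ∈-upTo⁺; ∈-upTo⁻; ∈-applyUpTo⁺)
open import Data.List.Relation.Unary.Any using (here; there)
open import Data.List.Relation.Unary.Any.Properties using (any⁺; any⁻)
open import Data.Nat using (ℕ; zero; suc; NonZero; _<_; _≤_; _≥_; _+_; _*_; _∸_; z≤n; s≤s; >-nonZero)
open import Data.Nat.Coprimality using (Coprime)
open import Data.Nat.Divisibility using (∣1⇒≡1)
open import Data.Nat.DivMod using (_%_; _/_; m<n⇒m%n≡m; m%n<n; m<n*o⇒m/o<n; m≡m%n+[m/n]*n)
open import Data.Nat.Primality using (Prime)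
open import Data.Nat.Properties
open import Data.Nat.Tactic.RingSolver using (solve-∀)
open import Data.Product using (Σ; _×_; _,_; proj₁)
open import Data.Rational using (ℚ; _-_; ½; -_; mkℚ; 1ℚ; *≤*) renaming (_+_ to _+ℚ_; _*_ to _*ℚ_; _≤_ to _≤ℚ_; _≥_ to _≥ℚ_; _/_ to _/ℚ_)
import Data.Rational.Properties as ℚ
open import Data.Rational.Solver using (module +-*-Solver)
open import Data.Sum using (inj₁; inj₂)
open import Data.Vec using ([]; _∷_; here; there; tabulate; lookup)
open import Data.Vec.Properties using ([]=⇒lookup)
open import Function using (_∘_; Equivalence)
open import Relation.Binary.PropositionalEquality
open import Relation.Nullary using (contradiction)
open import Relation.Nullary.Decidable using (fromWitness; toWitness)

∑< : ℕ → (ℕ → ℕ) → ℕ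
∑< zero    f = 0
∑< (suc n) f = ∑< n f + f n

syntax ∑< n (λ i → e) = ∑[ i < n ] e

∑<-+ : ∀ m n f → ∑< (m + n) f ≡ ∑< m f + ∑[ i < n ] f (m + i)
∑<-+ m zero    f = trans (cong (λ k → ∑< k f) (+-identityʳ m)) (sym (+-identityʳ _))
∑<-+ m (suc n) f = begin
  ∑< (m + suc n) f                              ≡⟨ cong (λ k → ∑< k f) (+-suc m n) ⟩
  ∑< (m + n) f + f (m + n)                      ≡⟨ cong (_+ f (m + n)) (∑<-+ m n f) ⟩
  ∑< m f + ∑[ i < n ] f (m + i) + f (m + n)     ≡⟨ +-assoc (∑< m f) _ _ ⟩
  ∑< m f + ∑[ i < suc n ] f (m + i)             ∎
  where open ≡-Reasoning

∑<-mono : ∀ n {f g} → (∀ i → i < n → f i ≤ g i) → ∑< n f ≤ ∑< n g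
∑<-mono zero    f≤g = z≤n
∑<-mono (suc n) f≤g = +-mono-≤ (∑<-mono n (λ i i<n → f≤g i (m<n⇒m<1+n i<n))) (f≤g n ≤-refl)

∑<-cong : ∀ n {f g} → (∀ i → f i ≡ g i) → ∑< n f ≡ ∑< n g
∑<-cong zero    f≡g = refl
∑<-cong (suc n) f≡g = cong₂ _+_ (∑<-cong n f≡g) (f≡g n)

∑<-blocks : ∀ m c f → ∑< (m * c) f ≡ ∑[ j < m ] ∑[ i < c ] f (j * c + i)
∑<-blocks zero    c f = refl
∑<-blocks (suc m) c f = begin
  ∑< (c + m * c) f                                  ≡⟨ cong (λ k → ∑< k f) (+-comm c (m * c)) ⟩
  ∑< (m * c + c) f                                  ≡⟨ ∑<-+ (m * c) c f ⟩
  ∑< (m * c) f + ∑[ i < c ] f (m * c + i)           ≡⟨ cong (_+ ∑[ i < c ] f (m * c + i)) (∑<-blocks m c f) ⟩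
  ∑[ j < suc m ] ∑[ i < c ] f (j * c + i)           ∎
  where open ≡-Reasoning

telescope : ∀ (β y : ℕ → ℕ) K m →
  (∀ j → j < m → β j + K ≤ y j + y (suc j)) → β m ≤ y m →
  ∑< (suc m) β + m * K ≤ ∑< (suc m) y + ∑< (suc m) y
telescope β y K m step last = begin
  ∑< m β + β m + m * K  ≡⟨ swap₂₃ (∑< m β) (β m) (m * K) ⟩
  ∑< m β + m * K + β m  ≤⟨ +-monoʳ-≤ _ last ⟩
  ∑< m β + m * K + y m  ≤⟨ chain m ≤-refl ⟩
  ∑< (suc m) y + ∑< (suc m) y ∎
  where
  open ≤-Reasoning
  swap₂₃ : ∀ a b c → a + b + c ≡ a + c + b
  swap₂₃ = solve-∀
  regroup : ∀ a b k l → a + b + (k + l) ≡ a + l + (b + k)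
  regroup = solve-∀
  interchange : ∀ a b c d → a + (b + c) + d ≡ a + b + (c + d)
  interchange = solve-∀
  double : ∀ a b → a + a + (b + b) ≡ a + b + (a + b)
  double = solve-∀
  chain : ∀ n → n ≤ m → ∑< n β + n * K + y n ≤ ∑< (suc n) y + ∑< (suc n) y
  chain zero    _     = m≤m+n (y 0) (y 0)
  chain (suc n) n<m = begin
    ∑< n β + β n + (K + n * K) + y (suc n)
      ≡⟨ cong (_+ y (suc n)) (regroup (∑< n β) (β n) K (n * K)) ⟩
    ∑< n β + n * K + (β n + K) + y (suc n)
      ≤⟨ +-monoˡ-≤ (y (suc n)) (+-monoʳ-≤ (∑< n β + n * K) (step n n<m)) ⟩
    ∑< n β + n * K + (y n + y (suc n)) + y (suc n)
      ≡⟨ interchange (∑< n β + n * K) (y n) (y (suc n)) (y (suc n)) ⟩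
    ∑< n β + n * K + y n + (y (suc n) + y (suc n))
      ≤⟨ +-monoˡ-≤ _ (chain n (<⇒≤ n<m)) ⟩
    ∑< (suc n) y + ∑< (suc n) y + (y (suc n) + y (suc n))
      ≡⟨ double (∑< (suc n) y) (y (suc n)) ⟩
    ∑< (suc (suc n)) y + ∑< (suc (suc n)) y ∎

doubled-sum-bound : ∀ {bI bO xI xO s k} → bI + k ≤ xI + xI → bI ≤ s → bO ≤ xO →
  (bI + bO) + (bI + bO) + k ≤ (xI + xO) + (xI + xO) + s
doubled-sum-bound {bI} {bO} {xI} {xO} {s} {k} inside bI≤s bO≤xO = begin
  (bI + bO) + (bI + bO) + k    ≡⟨ regroup bI bO k ⟩
  (bI + k) + bI + (bO + bO)    ≤⟨ +-mono-≤ (+-mono-≤ inside bI≤s) (+-mono-≤ bO≤xO bO≤xO) ⟩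
  (xI + xI) + s + (xO + xO)    ≡⟨ regroup′ xI xO s ⟩
  (xI + xO) + (xI + xO) + s    ∎
  where
  open ≤-Reasoning
  regroup : ∀ a b k → (a + b) + (a + b) + k ≡ (a + k) + a + (b + b)
  regroup = solve-∀
  regroup′ : ∀ a b s → (a + a) + s + (b + b) ≡ (a + b) + (a + b) + s
  regroup′ = solve-∀

count : (ℕ → Bool) → ℕ → ℕ
count f n = ∑[ i < n ] (if f i then 1 else 0)

count-monoˡ : ∀ n {f g} → (∀ i → i < n → f i ≡ true → g i ≡ true) → count f n ≤ count g n
count-monoˡ n {f} {g} f⇒g = ∑<-mono n indicator-mono
  where
  indicator-mono : ∀ i → i < n → (if f i then 1 else 0) ≤ (if g i then 1 else 0)
  indicator-mono i i<n with f i in fi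
  ... | false = z≤n
  ... | true  rewrite f⇒g i i<n fi = ≤-refl

count-split : ∀ f {m n} → m ≤ n → count f n ≡ count f m + count (λ i → f (m + i)) (n ∸ m)
count-split f {m} {n} m≤n = trans (cong (count f) (sym (m+[n∸m]≡n m≤n))) (∑<-+ m (n ∸ m) _)

count-monoʳ : ∀ f {m n} → m ≤ n → count f m ≤ count f n
count-monoʳ f {m} {n} m≤n =
  subst (count f m ≤_) (sym (count-split f m≤n)) (m≤m+n (count f m) (count (λ i → f (m + i)) (n ∸ m)))

count-false : ∀ f n → (∀ i → i < n → f i ≡ false) → count f n ≡ 0
count-false f zero    _ = refl
count-false f (suc n) f≡false rewrite f≡false n ≤-refl =
  trans (+-identityʳ _) (count-false f n (λ i i<n → f≡false i (m<n⇒m<1+n i<n)))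

count-pos : ∀ f {i n} → f i ≡ true → i < n → 0 < count f n
count-pos f {i} fi i<n = ≤-trans one≤ (count-monoʳ f i<n)
  where
  one≤ : 1 ≤ count f (suc i)
  one≤ rewrite fi = m≤n+m 1 (count f i)

window-bound : ∀ (fB fX fC : ℕ → Bool) c n →
  (∀ i → i < n → fB i ≡ true → fX i ≡ true) →
  (∀ i k → i < n → k < c → fB i ≡ true → fC k ≡ true → fX (i + k) ≡ true) →
  0 < count fB n →
  count fB n + count fC c ≤ suc (count fX (n + c))
window-bound fB fX fC c (suc n) B⊆X B+C⊆X pos with fB n in fBn
-- n is the largest element of fB in the window, so n + fC lies in [n, n + c), beyond the rest of fB.
... | true = begin
  count fB n + 1 + count fC c
    ≤⟨ +-mono-≤ (+-monoˡ-≤ 1 (count-monoˡ n below)) (count-monoˡ c shifted) ⟩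
  count fX n + 1 + count (λ k → fX (n + k)) c
    ≡⟨ trans (swap (count fX n) _) (cong suc (sym (∑<-+ n c _))) ⟩
  suc (count fX (n + c))
    ≤⟨ s≤s (count-monoʳ fX (n≤1+n (n + c))) ⟩
  suc (count fX (suc n + c)) ∎
  where
  open ≤-Reasoning
  swap : ∀ a b → a + 1 + b ≡ suc (a + b)
  swap = solve-∀
  below : ∀ i → i < n → fB i ≡ true → fX i ≡ true
  below i i<n = B⊆X i (m<n⇒m<1+n i<n)
  shifted : ∀ k → k < c → fC k ≡ true → fX (n + k) ≡ true
  shifted k k<c = B+C⊆X n k ≤-refl k<c fBn
... | false = begin
  count fB n + 0 + count fC c   ≡⟨ cong (_+ count fC c) (+-identityʳ _) ⟩
  count fB n + count fC c       ≤⟨ window-bound fB fX fC c n below (λ i k i<n → B+C⊆X i k (m<n⇒m<1+n i<n)) pos′ ⟩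
  suc (count fX (n + c))        ≤⟨ s≤s (count-monoʳ fX (n≤1+n (n + c))) ⟩
  suc (count fX (suc n + c))    ∎
  where
  open ≤-Reasoning
  below : ∀ i → i < n → fB i ≡ true → fX i ≡ true
  below i i<n = B⊆X i (m<n⇒m<1+n i<n)
  pos′ : 0 < count fB n
  pos′ = subst (0 <_) (+-identityʳ _) pos

blocks-bound : ∀ (fB fX fC : ℕ → Bool) c m K →
  (∀ b → fB b ≡ true → fX b ≡ true) →
  (∀ b k → b + k < suc m * c → fB b ≡ true → fC k ≡ true → fX (b + k) ≡ true) →
  (∀ j → j < m → 0 < count (λ i → fB (j * c + i)) c) →
  count fC c ≡ suc K →
  count fB (suc m * c) + m * K ≤ count fX (suc m * c) + count fX (suc m * c)
blocks-bound fB fX fC c m K B⊆X B+C⊆X nonempty ∣C∣≡1+K =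
  subst₂ (λ b x → b + m * K ≤ x + x) (sym (∑<-blocks (suc m) c _)) (sym (∑<-blocks (suc m) c _))
    (telescope β y K m adjacent (count-monoˡ c (λ i _ → B⊆X (m * c + i))))
  where
  β y : ℕ → ℕ
  β j = count (λ i → fB (j * c + i)) c
  y j = count (λ i → fX (j * c + i)) c

  two-blocks : ∀ j c → j * c + c + c ≡ suc (suc j) * c
  two-blocks = solve-∀
  next-block : ∀ j c i → j * c + (c + i) ≡ suc j * c + i
  next-block = solve-∀

  in-range : ∀ {j i k} → j < m → i < c → k < c → j * c + i + k < suc m * c
  in-range {j} j<m i<c k<c = begin-strict
    _                  <⟨ +-mono-< (+-monoʳ-< (j * c) i<c) k<c ⟩
    j * c + c + c      ≡⟨ two-blocks j c ⟩
    suc (suc j) * c    ≤⟨ *-monoˡ-≤ c (s≤s j<m) ⟩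
    suc m * c          ∎
    where open ≤-Reasoning

  y+y : ∀ j → count (λ i → fX (j * c + i)) (c + c) ≡ y j + y (suc j)
  y+y j = trans (∑<-+ c c _) (cong (y j +_) (∑<-cong c (λ i → cong (λ b → if fX b then 1 else 0) (next-block j c i))))

  adjacent : ∀ j → j < m → β j + K ≤ y j + y (suc j)
  adjacent j j<m = ≤-pred (begin
    suc (β j + K)   ≡⟨ +-suc (β j) K ⟨
    β j + suc K     ≡⟨ cong (β j +_) ∣C∣≡1+K ⟨
    β j + count fC c
      ≤⟨ window-bound (λ i → fB (j * c + i)) (λ i → fX (j * c + i)) fC c c
           (λ i _ → B⊆X (j * c + i)) B+C⊆X-shifted (nonempty j j<m) ⟩
    suc (count (λ i → fX (j * c + i)) (c + c)) ≡⟨ cong suc (y+y j) ⟩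
    suc (y j + y (suc j)) ∎)
    where
    open ≤-Reasoning
    B+C⊆X-shifted : ∀ i k → i < c → k < c → fB (j * c + i) ≡ true → fC k ≡ true → fX (j * c + (i + k)) ≡ true
    B+C⊆X-shifted i k i<c k<c fBi fCk =
      subst (λ b → fX b ≡ true) (+-assoc (j * c) i k) (B+C⊆X (j * c + i) k (in-range j<m i<c k<c) fBi fCk)

χ : ∀ {n} → Subset n → ℕ → Bool
χ []      _       = false
χ (b ∷ S) zero    = b
χ (b ∷ S) (suc k) = χ S k

∣∣≡count-χ : ∀ {n} (S : Subset n) → ∣ S ∣ ≡ count (χ S) n
∣∣≡count-χ []          = refl
∣∣≡count-χ {suc n} (b ∷ S) = trans (head b) (sym (∑<-+ 1 n _))
  where
  head : ∀ b → ∣ b ∷ S ∣ ≡ (if b then 1 else 0) + count (χ S) n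
  head true  = cong suc (∣∣≡count-χ S)
  head false = ∣∣≡count-χ S

∈⇒χ : ∀ {n} {S : Subset n} {x} → x ∈ S → χ S (toℕ x) ≡ true
∈⇒χ here      = refl
∈⇒χ (there x∈S) = ∈⇒χ x∈S

χ⇒∈ : ∀ {n} (S : Subset n) k → χ S k ≡ true → Σ (Fin n) λ x → toℕ x ≡ k × x ∈ S
χ⇒∈ (true ∷ S) zero    _ = zero , refl , here
χ⇒∈ (b ∷ S)    (suc k) χSk with χ⇒∈ S k χSk
... | x , refl , x∈S = suc x , refl , there x∈S

χ-mono : ∀ {n} {S S′ : Subset n} → S ⊆ S′ → ∀ k → χ S k ≡ true → χ S′ k ≡ true
χ-mono {S = S} S⊆S′ k χSk with χ⇒∈ S k χSk
... | x , refl , x∈S = ∈⇒χ (S⊆S′ x∈S)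

∣∣≡count-χ-below : ∀ {n} (S : Subset n) c → c ≤ n → (∀ x → x ∈ S → toℕ x < c) → ∣ S ∣ ≡ count (χ S) c
∣∣≡count-χ-below {n} S c c≤n S<c = begin
  ∣ S ∣                                                  ≡⟨ ∣∣≡count-χ S ⟩
  count (χ S) n                                          ≡⟨ count-split (χ S) c≤n ⟩
  count (χ S) c + count (λ i → χ S (c + i)) (n ∸ c)      ≡⟨ cong (count (χ S) c +_) (count-false _ (n ∸ c) above-c) ⟩
  count (χ S) c + 0                                      ≡⟨ +-identityʳ _ ⟩
  count (χ S) c                                          ∎
  where
  open ≡-Reasoning
  above-c : ∀ i → i < n ∸ c → χ S (c + i) ≡ false
  above-c i _ with χ S (c + i) in χSc+i
  ... | false = refl
  ... | true with χ⇒∈ S (c + i) χSc+i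
  ...   | x , x≡c+i , x∈S = contradiction (S<c x x∈S) (≤⇒≯ (subst (c ≤_) (sym x≡c+i) (m≤m+n c i)))

∈-tabulate⁺ : ∀ {n} (g : Fin n → Bool) x → T (g x) → x ∈ tabulate g
∈-tabulate⁺ g zero    gx with g zero
... | true = here
∈-tabulate⁺ g (suc x) gx = there (∈-tabulate⁺ (g ∘ suc) x gx)

∈-tabulate⁻ : ∀ {n} (g : Fin n → Bool) x → x ∈ tabulate g → T (g x)
∈-tabulate⁻ g zero    x∈ with g zero | x∈
... | true | _ = _
∈-tabulate⁻ g (suc x) (there x∈) = ∈-tabulate⁻ (g ∘ suc) x x∈

∈-⋃⁺ : ∀ {n} {x : Fin n} {q qs} → q ∈ᴸ qs → x ∈ q → x ∈ ⋃ qs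
∈-⋃⁺ (here refl) x∈q = x∈p∪q⁺ (inj₁ x∈q)
∈-⋃⁺ (there q∈)  x∈q = x∈p∪q⁺ (inj₂ (∈-⋃⁺ q∈ x∈q))

module _ {p : ℕ} .{{_ : NonZero p}} where

  ∈-⊕⁺ : ∀ {B C : Subset p} {b c} x → b ∈ B → c ∈ C → toℕ x ≡ (toℕ b + toℕ c) % p → x ∈ B ⊕ C
  ∈-⊕⁺ {B} {C} {b} {c} x b∈B c∈C x≡b+c =
    ∈-tabulate⁺ _ x (any⁺ _ (lose (∈-allFin b) (any⁺ _ (lose (∈-allFin c)
      (Equivalence.from T-∧ (T-lookup b∈B , Equivalence.from T-∧ (T-lookup c∈C , fromWitness x≡b+c)))))))
    where
    T-lookup : ∀ {S : Subset p} {y} → y ∈ S → T (lookup S y)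
    T-lookup y∈S = Equivalence.from T-≡ ([]=⇒lookup y∈S)

  ∈-segment⁺ : ∀ {a len j} x → j < len → toℕ x ≡ (a + j) % p → x ∈ segment a len
  ∈-segment⁺ x j<len x≡a+j = ∈-tabulate⁺ _ x (any⁺ _ (lose (∈-upTo⁺ j<len) (fromWitness x≡a+j)))

  ∈-segment⁻ : ∀ {a len} x → x ∈ segment a len → Σ ℕ λ j → j < len × toℕ x ≡ (a + j) % p
  ∈-segment⁻ x x∈ with find (any⁻ _ _ (∈-tabulate⁻ _ x x∈))
  ... | j , j∈ , x≡a+j = j , ∈-upTo⁻ j∈ , toWitness x≡a+j

  ∈-Iall⁺ : ∀ {c} t .{{_ : NonZero c}} (x : Fin p) → toℕ x < 2 * t * c → x ∈ Iall c t
  ∈-Iall⁺ {c} t x x<N =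
    ∈-⋃⁺ (∈-applyUpTo⁺ (λ i → Iᵢ c (suc i)) (m<n*o⇒m/o<n {n = 2 * t} x<N))
         (∈-segment⁺ x (m%n<n (toℕ x) c) x≡)
    where
    x≡ : toℕ x ≡ (toℕ x / c * c + toℕ x % c) % p
    x≡ = begin
      toℕ x                            ≡⟨ m<n⇒m%n≡m (toℕ<n x) ⟨
      toℕ x % p                        ≡⟨ cong (_% p) (m≡m%n+[m/n]*n (toℕ x) c) ⟩
      (toℕ x % c + toℕ x / c * c) % p  ≡⟨ cong (_% p) (+-comm (toℕ x % c) _) ⟩
      (toℕ x / c * c + toℕ x % c) % p  ∎
      where open ≡-Reasoning

  ∈-Iᵢ⁻ : ∀ {c j} x → x ∈ Iᵢ c (suc j) → suc j * c ≤ p → Σ ℕ λ i → i < c × toℕ x ≡ j * c + i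
  ∈-Iᵢ⁻ {c} {j} x x∈ block≤p with ∈-segment⁻ x x∈
  ... | i , i<c , x≡ = i , i<c , trans x≡ (m<n⇒m%n≡m (<-≤-trans (+-monoʳ-< (j * c) i<c) jc+c≤p))
    where
    jc+c≤p : j * c + c ≤ p
    jc+c≤p = subst (_≤ p) (+-comm c (j * c)) block≤p

module _ {p : ℕ} .{{_ : NonZero p}} (B C : Subset p) where

  B∪[B⊕C∩I]⊆B⊕C : (Σ (Fin p) λ z → toℕ z ≡ 0 × z ∈ C) → ∀ I → B ∪ ((B ⊕ C) ∩ I) ⊆ B ⊕ C
  B∪[B⊕C∩I]⊆B⊕C (z , z≡0 , z∈C) I {x} x∈ with x∈p∪q⁻ B _ x∈
  ... | inj₂ x∈B⊕C∩I = proj₁ (x∈p∩q⁻ (B ⊕ C) I x∈B⊕C∩I)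
  ... | inj₁ x∈B     = ∈-⊕⁺ x x∈B z∈C x≡x+z
    where
    x≡x+z : toℕ x ≡ (toℕ x + toℕ z) % p
    x≡x+z rewrite z≡0 | +-identityʳ (toℕ x) = sym (m<n⇒m%n≡m (toℕ<n x))

  module _ (c t : ℕ) .{{_ : NonZero c}} where

    private
      N = 2 * t * c
      I = Iall {p} c t
      X = B ∪ ((B ⊕ C) ∩ I)

    χB⇒χX : ∀ k → χ B k ≡ true → χ X k ≡ true
    χB⇒χX = χ-mono {S = B} {S′ = X} (λ x∈B → x∈p∪q⁺ (inj₁ x∈B))

    χB⇒χB∩I : ∀ k → k < N → χ B k ≡ true → χ (B ∩ I) k ≡ true
    χB⇒χB∩I k k<N χBk with χ⇒∈ B k χBk
    ... | x , refl , x∈B = ∈⇒χ (x∈p∩q⁺ (x∈B , ∈-Iall⁺ t x k<N))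

    χB+χC⇒χX : N < p → ∀ b k → b + k < N → χ B b ≡ true → χ C k ≡ true → χ X (b + k) ≡ true
    χB+χC⇒χX N<p b k b+k<N χBb χCk with χ⇒∈ B b χBb | χ⇒∈ C k χCk
    ... | xb , refl , xb∈B | xc , refl , xc∈C =
      subst (λ i → χ X i ≡ true) (toℕ-fromℕ< b+k<p) (∈⇒χ (x∈p∪q⁺ {p = B} (inj₂ (x∈p∩q⁺ (x∈B⊕C , x∈I)))))
      where
      b+k<p : toℕ xb + toℕ xc < p
      b+k<p = <-trans b+k<N N<p
      x = fromℕ< b+k<p
      x∈B⊕C : x ∈ B ⊕ C
      x∈B⊕C = ∈-⊕⁺ x xb∈B xc∈C (trans (toℕ-fromℕ< b+k<p) (sym (m<n⇒m%n≡m b+k<p)))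
      x∈I : x ∈ I
      x∈I = ∈-Iall⁺ t x (subst (_< N) (sym (toℕ-fromℕ< b+k<p)) b+k<N)

    block-count-pos : N < p → ∀ j → suc j ≤ 2 * t → Nonempty (B ∩ Iᵢ c (suc j)) →
      0 < count (λ i → χ B (j * c + i)) c
    block-count-pos N<p j j<2t (x , x∈B∩Iⱼ) with x∈p∩q⁻ B _ x∈B∩Iⱼ
    ... | x∈B , x∈Iⱼ with ∈-Iᵢ⁻ {c = c} {j = j} x x∈Iⱼ (≤-trans (*-monoˡ-≤ c j<2t) (<⇒≤ N<p))
    ...   | i , i<c , x≡jc+i = count-pos (λ i → χ B (j * c + i)) (subst (λ k → χ B k ≡ true) x≡jc+i (∈⇒χ x∈B)) i<c

  count-χ≡suc : ∀ c → c ≤ p → Nonempty C → (∀ x → x ∈ C → toℕ x < c) →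
    count (χ C) c ≡ suc (∣ C ∣ ∸ 1)
  count-χ≡suc c c≤p (z , z∈C) C<c = trans (sym ∣C∣≡count) (sym (m+[n∸m]≡n 0<∣C∣))
    where
    ∣C∣≡count : ∣ C ∣ ≡ count (χ C) c
    ∣C∣≡count = ∣∣≡count-χ-below C c c≤p C<c
    0<∣C∣ : 0 < ∣ C ∣
    0<∣C∣ = subst (0 <_) (sym ∣C∣≡count) (count-pos (χ C) (∈⇒χ z∈C) (C<c z z∈C))

  doubled-bound : ∀ c t .{{_ : NonZero c}} .{{_ : NonZero t}} →
    Nonempty C → (∀ x → x ∈ C → toℕ x < c) → 2 * t * c < p →
    (∀ i → 1 ≤ i → i ≤ 2 * t → Nonempty (B ∩ Iᵢ c i)) →
    ∣ B ∣ + ∣ B ∣ + (2 * t ∸ 1) * (∣ C ∣ ∸ 1)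
      ≤ ∣ B ∪ ((B ⊕ C) ∩ Iall c t) ∣ + ∣ B ∪ ((B ⊕ C) ∩ Iall c t) ∣ + ∣ B ∩ Iall c t ∣
  doubled-bound c t@(suc _) C≢∅ C<c N<p nonempty =
    subst₂ (λ b x → b + b + m * K ≤ x + x + ∣ B ∩ I ∣)
      (sym (trans (∣∣≡count-χ B) (count-split (χ B) N≤p)))
      (sym (trans (∣∣≡count-χ X) (count-split (χ X) N≤p)))
      (doubled-sum-bound {xI = count (χ X) N} inside-I inside-I∩B outside-I)
    where
    N = 2 * t * c
    m = 2 * t ∸ 1
    K = ∣ C ∣ ∸ 1
    I = Iall {p} c t
    X = B ∪ ((B ⊕ C) ∩ I)
    N≤p : N ≤ p
    N≤p = <⇒≤ N<p

    inside-I : count (χ B) N + m * K ≤ count (χ X) N + count (χ X) N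
    inside-I = blocks-bound (χ B) (χ X) (χ C) c m K (χB⇒χX c t) (χB+χC⇒χX c t N<p)
      (λ j j<m → block-count-pos c t N<p j (m≤n⇒m≤1+n j<m) (nonempty (suc j) (s≤s z≤n) (m≤n⇒m≤1+n j<m)))
      (count-χ≡suc c (≤-trans (m≤n*m c (2 * t)) N≤p) C≢∅ C<c)

    inside-I∩B : count (χ B) N ≤ ∣ B ∩ I ∣
    inside-I∩B = begin
      count (χ B) N        ≤⟨ count-monoˡ N (χB⇒χB∩I c t) ⟩
      count (χ (B ∩ I)) N  ≤⟨ count-monoʳ (χ (B ∩ I)) N≤p ⟩
      count (χ (B ∩ I)) p  ≡⟨ ∣∣≡count-χ (B ∩ I) ⟨
      ∣ B ∩ I ∣            ∎
      where open ≤-Reasoning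

    outside-I : count (λ i → χ B (N + i)) (p ∸ N) ≤ count (λ i → χ X (N + i)) (p ∸ N)
    outside-I = count-monoˡ (p ∸ N) (λ i _ → χB⇒χX c t (N + i))

coprime-1 : ∀ n → Coprime n 1
coprime-1 n (_ , d∣1) = ∣1⇒≡1 d∣1

ℕ→ℚ≡mkℚ : ∀ n → ℕ→ℚ n ≡ mkℚ (ℤ.+ n) 0 (coprime-1 n)
ℕ→ℚ≡mkℚ n = ℚ.normalize-coprime (coprime-1 n)

ℕ→ℚ-+ : ∀ m n → ℕ→ℚ (m + n) ≡ ℕ→ℚ m +ℚ ℕ→ℚ n
ℕ→ℚ-+ m n rewrite ℕ→ℚ≡mkℚ m | ℕ→ℚ≡mkℚ n =
  ℚ./-cong (sym (cong₂ ℤ._+_ (ℤ.*-identityʳ (ℤ.+ m)) (ℤ.*-identityʳ (ℤ.+ n)))) refl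

ℕ→ℚ-* : ∀ m n → ℕ→ℚ (m * n) ≡ ℕ→ℚ m *ℚ ℕ→ℚ n
ℕ→ℚ-* m n rewrite ℕ→ℚ≡mkℚ m | ℕ→ℚ≡mkℚ n = ℚ./-cong (ℤ.pos-* m n) refl

ℕ→ℚ-mono-≤ : ∀ {m n} → m ≤ n → ℕ→ℚ m ≤ℚ ℕ→ℚ n
ℕ→ℚ-mono-≤ {m} {n} m≤n rewrite ℕ→ℚ≡mkℚ m | ℕ→ℚ≡mkℚ n =
  *≤* (subst₂ ℤ._≤_ (sym (ℤ.*-identityʳ (ℤ.+ m))) (sym (ℤ.*-identityʳ (ℤ.+ n))) (ℤ.+≤+ m≤n))

ℕ→ℚ-*-÷ℕ : ∀ q n .{{_ : NonZero n}} → ℕ→ℚ n *ℚ (q ÷ℕ n) ≡ q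
ℕ→ℚ-*-÷ℕ q (suc k) = begin
  ℕ→ℚ (suc k) *ℚ (q *ℚ (ℤ.+ 1 /ℚ suc k))   ≡⟨ swap (ℕ→ℚ (suc k)) q _ ⟩
  q *ℚ (ℕ→ℚ (suc k) *ℚ (ℤ.+ 1 /ℚ suc k))   ≡⟨ cong (q *ℚ_) inverse ⟩
  q *ℚ 1ℚ                                ≡⟨ ℚ.*-identityʳ q ⟩
  q                                      ∎
  where
  open ≡-Reasoning
  open +-*-Solver
  swap : ∀ a b c → a *ℚ (b *ℚ c) ≡ b *ℚ (a *ℚ c)
  swap = solve 3 (λ a b c → a :* (b :* c) := b :* (a :* c)) refl
  inverse : ℕ→ℚ (suc k) *ℚ (ℤ.+ 1 /ℚ suc k) ≡ 1ℚ
  inverse rewrite ℕ→ℚ≡mkℚ (suc k) | ℚ.normalize-coprime {1} {k} (λ (d∣1 , _) → ∣1⇒≡1 d∣1) =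
    ℚ.*-inverseʳ (mkℚ (ℤ.+ suc k) 0 (coprime-1 (suc k)))

halve : ∀ x b s e → b +ℚ b +ℚ e ≤ℚ x +ℚ x +ℚ s → b +ℚ ½ *ℚ (e - s) ≤ℚ x
halve x b s e hyp = begin
  b +ℚ ½ *ℚ (e - s)                  ≡⟨ regroup b e s ⟩
  ½ *ℚ (b +ℚ b +ℚ e) +ℚ - (½ *ℚ s)   ≤⟨ ℚ.+-monoˡ-≤ (- (½ *ℚ s)) (ℚ.*-monoˡ-≤-nonNeg ½ hyp) ⟩
  ½ *ℚ (x +ℚ x +ℚ s) +ℚ - (½ *ℚ s)   ≡⟨ cancel x s ⟩
  x                                   ∎
  where
  open ℚ.≤-Reasoning
  open +-*-Solver
  regroup : ∀ b e s → b +ℚ ½ *ℚ (e - s) ≡ ½ *ℚ (b +ℚ b +ℚ e) +ℚ - (½ *ℚ s)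
  regroup = solve 3 (λ b e s → b :+ con ½ :* (e :- s) := con ½ :* (b :+ b :+ e) :+ (:- (con ½ :* s))) refl
  cancel : ∀ x s → ½ *ℚ (x +ℚ x +ℚ s) +ℚ - (½ *ℚ s) ≡ x
  cancel = solve 2 (λ x s → con ½ :* (x :+ x :+ s) :+ (:- (con ½ :* s)) := x) refl

ℕ→ℚ-minus-½ : ∀ t .{{_ : NonZero t}} → ℕ→ℚ t - ½ ≡ ½ *ℚ ℕ→ℚ (2 * t ∸ 1)
ℕ→ℚ-minus-½ t@(suc t′) = begin
  ℕ→ℚ t - ½                    ≡⟨ halve-double (ℕ→ℚ t) ⟩
  ½ *ℚ (ℕ→ℚ t +ℚ ℕ→ℚ t) - ½    ≡⟨ cong (λ e → ½ *ℚ e - ½) (sym (ℕ→ℚ-+ t t)) ⟩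
  ½ *ℚ ℕ→ℚ (t + t) - ½         ≡⟨ cong (λ n → ½ *ℚ ℕ→ℚ (suc (t′ + suc n)) - ½) (+-identityʳ t′) ⟨
  ½ *ℚ ℕ→ℚ (2 * t) - ½         ≡⟨ cong (λ e → ½ *ℚ e - ½) (ℕ→ℚ-+ 1 (2 * t ∸ 1)) ⟩
  ½ *ℚ (1ℚ +ℚ ℕ→ℚ (2 * t ∸ 1)) - ½ ≡⟨ halve-succ (ℕ→ℚ (2 * t ∸ 1)) ⟩
  ½ *ℚ ℕ→ℚ (2 * t ∸ 1)         ∎
  where
  open ≡-Reasoning
  open +-*-Solver
  halve-double : ∀ a → a - ½ ≡ ½ *ℚ (a +ℚ a) - ½
  halve-double = solve 1 (λ a → a :- con ½ := con ½ :* (a :+ a) :- con ½) refl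
  halve-succ : ∀ a → ½ *ℚ (1ℚ +ℚ a) - ½ ≡ ½ *ℚ a
  halve-succ = solve 1 (λ a → con ½ :* (con 1ℚ :+ a) :- con ½ := con ½ :* a) refl

rational-bound : ∀ x b s k c t .{{_ : NonZero c}} .{{_ : NonZero t}} →
  b + b + (2 * t ∸ 1) * k ≤ x + x + s →
  ℕ→ℚ b +ℚ (ℕ→ℚ t - ½) *ℚ ℕ→ℚ c *ℚ (ℕ→ℚ k ÷ℕ c - ℕ→ℚ s ÷ℕ ((2 * t ∸ 1) * c)) ≤ℚ ℕ→ℚ x
rational-bound x b s k c t@(suc t′) hyp = begin
  ℕ→ℚ b +ℚ (ℕ→ℚ t - ½) *ℚ ℕ→ℚ c *ℚ (u - v)
    ≡⟨ cong (λ h → ℕ→ℚ b +ℚ h *ℚ ℕ→ℚ c *ℚ (u - v)) (ℕ→ℚ-minus-½ t) ⟩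
  ℕ→ℚ b +ℚ ½ *ℚ ℕ→ℚ d *ℚ ℕ→ℚ c *ℚ (u - v)
    ≡⟨ distribute (ℕ→ℚ b) (ℕ→ℚ d) (ℕ→ℚ c) u v ⟩
  ℕ→ℚ b +ℚ ½ *ℚ (ℕ→ℚ d *ℚ (ℕ→ℚ c *ℚ u) - ℕ→ℚ d *ℚ ℕ→ℚ c *ℚ v)
    ≡⟨ cong₂ (λ e f → ℕ→ℚ b +ℚ ½ *ℚ (ℕ→ℚ d *ℚ e - f)) (ℕ→ℚ-*-÷ℕ (ℕ→ℚ k) c) dc*v≡s ⟩
  ℕ→ℚ b +ℚ ½ *ℚ (ℕ→ℚ d *ℚ ℕ→ℚ k - ℕ→ℚ s)
    ≤⟨ halve (ℕ→ℚ x) (ℕ→ℚ b) (ℕ→ℚ s) _ hypℚ ⟩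
  ℕ→ℚ x ∎
  where
  open ℚ.≤-Reasoning
  open +-*-Solver
  d = 2 * t ∸ 1
  instance
    d-nonZero : NonZero d
    d-nonZero = >-nonZero (≤-trans (s≤s z≤n) (m≤n+m _ t′))
  u = ℕ→ℚ k ÷ℕ c
  v = ℕ→ℚ s ÷ℕ (d * c)

  dc*v≡s : ℕ→ℚ d *ℚ ℕ→ℚ c *ℚ v ≡ ℕ→ℚ s
  dc*v≡s = trans (cong (_*ℚ v) (sym (ℕ→ℚ-* d c))) (ℕ→ℚ-*-÷ℕ (ℕ→ℚ s) (d * c) {{m*n≢0 d c}})

  distribute : ∀ b d c u v → b +ℚ ½ *ℚ d *ℚ c *ℚ (u - v) ≡ b +ℚ ½ *ℚ (d *ℚ (c *ℚ u) - d *ℚ c *ℚ v)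
  distribute = solve 5 (λ b d c u v → b :+ con ½ :* d :* c :* (u :- v) := b :+ con ½ :* (d :* (c :* u) :- d :* c :* v)) refl

  hypℚ : ℕ→ℚ b +ℚ ℕ→ℚ b +ℚ ℕ→ℚ d *ℚ ℕ→ℚ k ≤ℚ ℕ→ℚ x +ℚ ℕ→ℚ x +ℚ ℕ→ℚ s
  hypℚ = subst₂ _≤ℚ_ cast cast′ (ℕ→ℚ-mono-≤ hyp)
    where
    cast : ℕ→ℚ (b + b + d * k) ≡ ℕ→ℚ b +ℚ ℕ→ℚ b +ℚ ℕ→ℚ d *ℚ ℕ→ℚ k
    cast = trans (ℕ→ℚ-+ (b + b) (d * k)) (cong₂ _+ℚ_ (ℕ→ℚ-+ b b) (ℕ→ℚ-* d k))
    cast′ : ℕ→ℚ (x + x + s) ≡ ℕ→ℚ x +ℚ ℕ→ℚ x +ℚ ℕ→ℚ s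
    cast′ = trans (ℕ→ℚ-+ (x + x) s) (cong (_+ℚ ℕ→ℚ s) (ℕ→ℚ-+ x x))

lemma4p5 : (p : ℕ) .{{_ : NonZero p}} → Prime p →
    (C : Subset p) → Σ (Fin p) (λ z → toℕ z ≡ 0 × z ∈ C) →
    (c : ℕ) → IsℓOf C c → 2 * c < p →
    (∀ x → x ∈ C → toℕ x < c) →
    (t : ℕ) → 1 ≤ t → 2 * t * c < p →
    (B : Subset p) →
    (∀ i → 1 ≤ i → i ≤ 2 * t → Nonempty (B ∩ Iᵢ c i)) →
    (∣ B ⊕ C ∣ ≥ ∣ B ∪ ((B ⊕ C) ∩ Iall c t) ∣) ×
    (ℕ→ℚ ∣ B ∪ ((B ⊕ C) ∩ Iall c t) ∣ ≥ℚ
      ℕ→ℚ ∣ B ∣ +ℚ (ℕ→ℚ t - ½) *ℚ ℕ→ℚ c *ℚ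
        (ρ ∣ C ∣ c - (ℕ→ℚ ∣ B ∩ Iall c t ∣ ÷ℕ ((2 * t ∸ 1) * c))))
lemma4p5 _ _ C (z , _ , z∈C) zero _ _ C<c _ _ _ _ _ = contradiction (C<c z z∈C) n≮0
lemma4p5 _ _ C 0∈C@(z , _ , z∈C) c@(suc _) _ _ C<c t@(suc _) _ N<p B nonempty =
    p⊆q⇒∣p∣≤∣q∣ (B∪[B⊕C∩I]⊆B⊕C B C 0∈C (Iall c t))
  , rational-bound (∣ B ∪ ((B ⊕ C) ∩ Iall c t) ∣) (∣ B ∣) (∣ B ∩ Iall c t ∣) (∣ C ∣ ∸ 1) c t
      (doubled-bound B C c t (z , z∈C) C<c N<p nonempty)
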